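{- Consider a stable defeasible logic with tag $d$, whose $+d$ inference rule is "We may append $+d\,q$ to $P$ if $C$". If the logic supports the (revised) Principle of Strong Negation, then $C\wedge\mathrm{sneg}(C)$ is proof-unsatisfiable if and only if $d$ is coherent.
   Context: A defeasible theory $D=(F,R,>)$ consists of a finite set $F$ of literals, a finite set $R$ of rules (each with a finite antecedent set of literals, a type strict/defeasible/defeater and a consequent literal) and an acyclic relation $>$ on $R$. Conclusions have the form $+d\,q$ or $-d\,q$. A defeasible logic is a finite set of inference rules "We may append $\pm d\,q$ to $P$ if $C$", one per tag, with applicability conditions $C(D,q,P)$; a proof from $D$ is a finite sequence of conclusions each appendable by some rule to the sequence preceding it, and $D\vdash c$ if $c$ occurs in some proof from $D$. An applicability condition is a first-order formula in negation normal form (negation only on atomic formulas; connectives $\wedge,\vee,\exists,\forall$) whose atomic formulas are pure atomic formulas (comparisons of elements of $D$, arithmetic and set comparisons; no tagged literals) or proof atomic formulas $\pm d'p\in X$ with $X$ either the current proof $P$ or a pre-defined set of conclusions; $c\notin X$ abbreviates $\neg(c\in X)$. Strong negation: $\mathrm{sneg}(+d p\in X)= -dp\in X$; $\mathrm{sneg}(-dp\in X)=+dp\in X$; $\mathrm{sneg}(+dp\notin X)=+dp\in X$; $\mathrm{sneg}(-dp\notin X)=-dp\in X$; $\mathrm{sneg}(A\wedge B)=\mathrm{sneg}(A)\vee\mathrm{sneg}(B)$; $\mathrm{sneg}(A\vee B)=\mathrm{sneg}(A)\wedge\mathrm{sneg}(B)$; $\mathrm{sneg}(\exists x\,A)=\forall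 x\,\mathrm{sneg}(A)$; $\mathrm{sneg}(\forall x\,A)=\exists x\,\mathrm{sneg}(A)$; $\mathrm{sneg}(\neg A)=A$ and $\mathrm{sneg}(A)=\neg A$ for pure atomic $A$. The logic supports the Principle of Strong Negation if for every tag $d$, whenever the $+d$ rule has applicability condition $C$, the $-d$ rule is "We may append $-d\,q$ to $P$ if $\mathrm{sneg}(C)$". An inference rule is stable if for every proof $P$ and every proof $Q$ containing $P$ as a subsequence, $C(P)\rightarrow C(Q)$; a logic is stable if all its rules are. A tag $d$ is coherent if for no $D$ and literal $q$ both $D\vdash +dq$ and $D\vdash -dq$. A formula $\psi(D,q,P)$ is proof-satisfiable if there exist $D$, a literal $q$ and a proof $P$ from $D$ such that $\psi(D,q,P)$ holds; proof-unsatisfiable otherwise. -}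

module Defs where

open import Data.Nat using (ℕ)
open import Data.Bool using (Bool)
open import Data.Fin using (Fin)
open import Data.List using (List; []; _∷_; _++_)
open import Data.List.Membership.Propositional using (_∈_)
open import Data.List.Relation.Unary.All using (All)
open import Data.List.Relation.Binary.Sublist.Propositional using (_⊆_)
open import Data.Product using (Σ; _×_; _,_)
open import Data.Sum using (_⊎_)
open import Relation.Nullary using (¬_)
open import Relation.Binary.PropositionalEquality using (_≡_)
open import Relation.Binary.Construct.Closure.Transitive using (TransClosure)

-- A literal: an atom (propositional letter, indexed by ℕ) with a polarity
-- (true = positive atom p, false = its negation ¬p).
record Literal : Set where
  constructor mkLit
  field
    positive : Bool
    atom     : ℕ

data RuleType : Set where
  strict defeasible defeater : RuleType

record Rule : Set where
  constructor rule
  field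
    antecedent : List Literal
    type       : RuleType
    consequent : Literal

record Theory : Set where
  field
    facts    : List Literal
    rules    : List Rule
    sup      : List (Rule × Rule)          -- the pairs r > s
    supOnR   : All (λ rs → (Data.Product.proj₁ rs ∈ rules) × (Data.Product.proj₂ rs ∈ rules)) sup
    acyclic  : ∀ r → ¬ TransClosure (λ a b → (a , b) ∈ sup) r r

data Sign : Set where
  plus minus : Sign

record Conclusion (n : ℕ) : Set where
  constructor concl
  field
    sign : Sign
    tag  : Fin n
    literal : Literal

Seq : ℕ → Set
Seq n = List (Conclusion n)

-- Applicability conditions: first-order formulas in negation normal form.
-- Quantifiers are represented higher-order (a quantifier over a domain A
-- binds a Agda variable of type A); pure atomic formulas are arbitrary
-- propositions (comparisons etc.) that do not mention tagged literals.

-- X in a proof atomic formula ±d'p ∈ X: the current proof P, or a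
-- pre-defined set of conclusions.
data Target (n : ℕ) : Set₁ where
  current : Target n
  fixed   : (Conclusion n → Set) → Target n

data Form (n : ℕ) : Set₁ where
  pure    : Set → Form n
  npure   : Set → Form n
  mem     : Conclusion n → Target n → Form n
  nmem    : Conclusion n → Target n → Form n
  and     : Form n → Form n → Form n
  or      : Form n → Form n → Form n
  ex      : {A : Set} → (A → Form n) → Form n
  all     : {A : Set} → (A → Form n) → Form n

_∈T_ : ∀ {n} → Conclusion n → Target n → Seq n → Set
(c ∈T current) P = c ∈ P
(c ∈T fixed S) P = S c

⟦_⟧ : ∀ {n} → Form n → Seq n → Set
⟦ pure A ⟧ P   = A
⟦ npure A ⟧ P  = ¬ A
⟦ mem c X ⟧ P  = (c ∈T X) P
⟦ nmem c X ⟧ P = ¬ (c ∈T X) P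
⟦ and A B ⟧ P  = ⟦ A ⟧ P × ⟦ B ⟧ P
⟦ or A B ⟧ P   = ⟦ A ⟧ P ⊎ ⟦ B ⟧ P
⟦ ex {A} f ⟧ P  = Σ A (λ x → ⟦ f x ⟧ P)
⟦ all {A} f ⟧ P = (x : A) → ⟦ f x ⟧ P

flipSign : Sign → Sign
flipSign plus  = minus
flipSign minus = plus

sneg : ∀ {n} → Form n → Form n
sneg (pure A)  = npure A
sneg (npure A) = pure A
sneg (mem (concl s t p) X)  = mem (concl (flipSign s) t p) X
sneg (nmem (concl s t p) X) = mem (concl s t p) X
sneg (and A B) = or (sneg A) (sneg B)
sneg (or A B)  = and (sneg A) (sneg B)
sneg (ex f)    = all (λ x → sneg (f x))
sneg (all f)   = ex (λ x → sneg (f x))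

-- Defeasible logics: finitely many tags, and for each tag d an inference
-- rule for +d and one for −d, given by applicability conditions C(D,q,P)
-- (P being the current proof, the 'current' target).

record Logic : Set₁ where
  field
    nTags : ℕ
    cond  : Sign → Fin nTags → Theory → Literal → Form nTags

module _ (L : Logic) where
  open Logic L

  Tag : Set
  Tag = Fin nTags

  Appendable : Theory → Seq nTags → Conclusion nTags → Set
  Appendable D P (concl s t q) = ⟦ cond s t D q ⟧ P

  data IsProof (D : Theory) : Seq nTags → Set where
    empty : IsProof D []
    snoc  : ∀ {P c} → IsProof D P → Appendable D P c → IsProof D (P ++ c ∷ [])

  Derives : Theory → Conclusion nTags → Set
  Derives D c = Σ (Seq nTags) (λ P → IsProof D P × c ∈ P)

  SupportsPSN : Set₁
  SupportsPSN = ∀ (d : Tag) D q → cond minus d D q ≡ sneg (cond plus d D q)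

  StableRule : Sign → Tag → Set
  StableRule s d = ∀ D q (P Q : Seq nTags) → IsProof D P → IsProof D Q → P ⊆ Q →
                   ⟦ cond s d D q ⟧ P → ⟦ cond s d D q ⟧ Q

  Stable : Set
  Stable = ∀ s d → StableRule s d

  Coherent : Tag → Set
  Coherent d = ¬ Σ Theory (λ D → Σ Literal (λ q →
                 Derives D (concl plus d q) × Derives D (concl minus d q)))

  ProofSatisfiable : (Theory → Literal → Form nTags) → Set
  ProofSatisfiable ψ = Σ Theory (λ D → Σ Literal (λ q → Σ (Seq nTags) (λ P →
                         IsProof D P × ⟦ ψ D q ⟧ P)))

  ProofUnsatisfiable : (Theory → Literal → Form nTags) → Set
  ProofUnsatisfiable ψ = ¬ ProofSatisfiable ψ

-- If C and sneg C held together after some proof P, then both +d q and −d q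
-- could be appended to P, so d is incoherent. Conversely, if +d q and −d q
-- are both derivable, each was appended to some proof, P₁ and P₂ say; P₁ ++ P₂
-- is again a proof, and by stability it still satisfies C (inherited from P₁)
-- and the −d condition, which by strong negation is sneg C (inherited from P₂).
module Submission where

open import Defs
open import Function.Bundles using (_⇔_; mk⇔; Equivalence)
open import Data.List using ([]; _∷_; _++_)
open import Data.List.Properties using (++-identityʳ; ++-assoc)
open import Data.List.Membership.Propositional using (_∈_)
open import Data.List.Membership.Propositional.Properties using (∈-++⁻; ∈-++⁺ʳ)
open import Data.List.Relation.Unary.Any using (here)
open import Data.List.Relation.Binary.Sublist.Propositional using (_⊆_; ⊆-refl)
open import Data.List.Relation.Binary.Sublist.Propositional.Properties using (++⁺ˡ; ++⁺ʳ)
open import Data.Product using (Σ; _×_; _,_)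
open import Data.Sum using (inj₁; inj₂)
open import Relation.Binary.PropositionalEquality using (refl; sym; subst)

module _ (L : Logic) where
  open Logic L

  Conflict : Tag L → Theory → Literal → Form nTags
  Conflict d D q = and (cond plus d D q) (sneg (cond plus d D q))

  Incoherence : Tag L → Set
  Incoherence d = Σ Theory λ D → Σ Literal λ q →
                    Derives L D (concl plus d q) × Derives L D (concl minus d q)

  appendable-minus⇔sneg : SupportsPSN L → ∀ d D q P →
                          Appendable L D P (concl minus d q) ⇔ ⟦ sneg (cond plus d D q) ⟧ P
  appendable-minus⇔sneg psn d D q P =
    mk⇔ (subst (λ F → ⟦ F ⟧ P) (psn d D q)) (subst (λ F → ⟦ F ⟧ P) (sym (psn d D q)))

  ∈-proof⇒appended-to-proof : ∀ {D P c} → IsProof L D P → c ∈ P →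
                              Σ (Seq nTags) λ Q → IsProof L D Q × Appendable L D Q c
  ∈-proof⇒appended-to-proof (snoc {P} pP app) c∈P++c with ∈-++⁻ P c∈P++c
  ... | inj₁ c∈P         = ∈-proof⇒appended-to-proof pP c∈P
  ... | inj₂ (here refl) = P , pP , app

  ++-proof : Stable L → ∀ {D P Q} → IsProof L D P → IsProof L D Q → IsProof L D (P ++ Q)
  ++-proof stable {P = P} pP empty rewrite ++-identityʳ P = pP
  ++-proof stable {D} {P} pP (snoc {Q} {concl s t q} pQ app)
    rewrite sym (++-assoc P Q (concl s t q ∷ [])) =
    snoc pPQ (stable s t D q Q (P ++ Q) pQ pPQ (++⁺ˡ P ⊆-refl) app)
    where pPQ = ++-proof stable pP pQ

  satisfiable⇒incoherence : SupportsPSN L → ∀ d →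
                            ProofSatisfiable L (Conflict d) → Incoherence d
  satisfiable⇒incoherence psn d (D , q , P , pP , C , snegC) =
      D , q
    , (P ++ concl plus d q ∷ [] , snoc pP C , ∈-++⁺ʳ P (here refl))
    , (P ++ concl minus d q ∷ [] , snoc pP minusC , ∈-++⁺ʳ P (here refl))
    where minusC = Equivalence.from (appendable-minus⇔sneg psn d D q P) snegC

  incoherence⇒satisfiable : Stable L → SupportsPSN L → ∀ d →
                            Incoherence d → ProofSatisfiable L (Conflict d)
  incoherence⇒satisfiable stable psn d (D , q , (_ , pr₁ , +dq∈) , (_ , pr₂ , -dq∈))
    with ∈-proof⇒appended-to-proof pr₁ +dq∈ | ∈-proof⇒appended-to-proof pr₂ -dq∈
  ... | P₁ , pP₁ , C | P₂ , pP₂ , minusC =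
      D , q , P₁ ++ P₂ , pP₁₂
    , stable plus d D q P₁ (P₁ ++ P₂) pP₁ pP₁₂ (++⁺ʳ P₂ ⊆-refl) C
    , Equivalence.to (appendable-minus⇔sneg psn d D q (P₁ ++ P₂))
        (stable minus d D q P₂ (P₁ ++ P₂) pP₂ pP₁₂ (++⁺ˡ P₁ ⊆-refl) minusC)
    where pP₁₂ = ++-proof stable pP₁ pP₂

corollary1 : (L : Logic) (d : Tag L) → Stable L → SupportsPSN L →
    ProofUnsatisfiable L (λ D q → and (Logic.cond L plus d D q) (sneg (Logic.cond L plus d D q)))
    ⇔ Coherent L d
corollary1 L d stable psn =
  mk⇔ (λ unsat incoherent → unsat (incoherence⇒satisfiable L stable psn d incoherent))
      (λ coherent sat → coherent (satisfiable⇒incoherence L psn d sat))
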